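{- If $G$ is the elementary abelian $2$-group of order $n=2^r$, then $C_3(G)=n/2+1$.
   Context: $G$ is written additively. For $A\subseteq G$ and a positive integer $h$, $h\hat{\;}A$ denotes the set of all sums of $h$ pairwise distinct elements of $A$. $C_h(G)=\max\{|A| : A\subseteq G,\ h\hat{\;}A\neq G\}$. -}

module Defs where

open import Data.Bool using (Bool; false; _xor_)
open import Data.Nat using (ℕ; _≤_)
open import Data.Vec using (Vec; zipWith; replicate)
open import Data.List using (List; foldr; length)
open import Data.List.Relation.Unary.Unique.Propositional using (Unique)
open import Data.List.Relation.Binary.Sublist.Propositional using (_⊆_)
open import Data.Product using (Σ; ∃; _×_)
open import Relation.Binary.PropositionalEquality using (_≡_)
open import Relation.Nullary using (¬_)

-- The elementary abelian 2-group of order 2^r: (Z/2)^r, i.e. bit vectors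
-- of length r under coordinatewise xor.
E2 : ℕ → Set
E2 r = Vec Bool r

_⊕_ : ∀ {r} → E2 r → E2 r → E2 r
_⊕_ = zipWith _xor_

𝟘 : ∀ {r} → E2 r
𝟘 = replicate _ false

Σ⊕ : ∀ {r} → List (E2 r) → E2 r
Σ⊕ = foldr _⊕_ 𝟘

-- A finite subset of G is represented by a duplicate-free list.
-- g ∈ h^A : g is a sum of h pairwise distinct elements of A, i.e. the sum
-- of some sub-list of A of length h (A being duplicate-free, sub-lists of
-- A are exactly the subsets of A).
_∈_^_ : ∀ {r} → E2 r → ℕ → List (E2 r) → Set
g ∈ h ^ A = Σ (List (E2 _)) λ B → B ⊆ A × length B ≡ h × Σ⊕ B ≡ g

RestrictedSumsetProper : ∀ {r} → ℕ → List (E2 r) → Set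
RestrictedSumsetProper {r} h A = ¬ (∀ (g : E2 r) → g ∈ h ^ A)

IsC : ℕ → (r : ℕ) → ℕ → Set
IsC h r m =
  (Σ (List (E2 r)) λ A → Unique A × length A ≡ m × RestrictedSumsetProper h A)
  × (∀ (A : List (E2 r)) → Unique A → RestrictedSumsetProper h A → length A ≤ m)

-- Lower bound: A = {0} ∪ (G ∖ H), H the hyperplane x₀ = 0, has 2^r + 1 elements; three elements
-- of G ∖ H never sum to 0 (their first coordinate is 1 + 1 + 1), and 0 + a + b = 0 forces a = b.
-- Upper bound: if |A| ≥ 2^r + 2 and g ∈ G, pick a ∈ A with a ≠ g. The set A ∖ {a} has more than
-- half of the elements of G, so it meets its translate by a + g ≠ 0: some b, b + a + g lie in it,
-- and g = a + b + (b + a + g) is a sum of three distinct elements of A.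

{-# OPTIONS --safe #-}
module Submission where

open import Defs
open import Data.Nat using (ℕ; zero; suc; _+_; _*_; _^_; _≤_; _<_; z≤n; s≤s)
open import Data.Nat.Properties
  using (≤-trans; ≤-reflexive; +-comm; +-suc; +-identityʳ; *-cancelˡ-≤; <⇒≱; ≮⇒≥)
open import Data.Bool using (true; false)
import Data.Bool.Properties as Bool
open import Data.Vec using ([]; _∷_)
open import Data.Vec.Properties using (≡-dec; ∷-injectiveʳ)
open import Data.List using (List; []; _∷_; length; map; _++_)
open import Data.List.Properties using (length-++; length-map)
open import Data.List.Relation.Unary.All as All using (All; []; _∷_)
open import Data.List.Relation.Unary.All.Properties as All using ()
open import Data.List.Relation.Unary.Any using (here; there; any?)
open import Data.List.Relation.Unary.Unique.Propositional using (Unique)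
open import Data.List.Relation.Unary.AllPairs using ([]; _∷_)
import Data.List.Relation.Unary.Unique.Propositional.Properties as Unique
open import Data.List.Membership.Propositional
  using (find; lose) renaming (_∈_ to _∈ₗ_; _∉_ to _∉ₗ_)
open import Data.List.Membership.Propositional.Properties
  using (∈-∃++; ∈-++⁻; ∈-++⁺ˡ; ∈-++⁺ʳ; ∈-map⁺; ∈-map⁻)
open import Data.List.Relation.Binary.Sublist.Propositional
  using (_⊆_; []; _∷_; _∷ʳ_; from∈)
open import Data.List.Relation.Binary.Sublist.Propositional.Properties using (All-resp-⊆)
open import Data.Product using (∃; _×_; _,_)
open import Data.Sum using (inj₁; inj₂)
open import Data.Empty using (⊥-elim)
open import Function using (_∘_)
open import Relation.Nullary using (¬_; yes; no)
open import Relation.Binary.Definitions using (DecidableEquality)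
open import Relation.Binary.PropositionalEquality
  using (_≡_; _≢_; refl; sym; trans; cong; cong₂; subst; module ≡-Reasoning)

⊕-comm : ∀ {r} (x y : E2 r) → x ⊕ y ≡ y ⊕ x
⊕-comm []      []      = refl
⊕-comm (a ∷ x) (b ∷ y) = cong₂ _∷_ (Bool.xor-comm a b) (⊕-comm x y)

⊕-assoc : ∀ {r} (x y z : E2 r) → (x ⊕ y) ⊕ z ≡ x ⊕ (y ⊕ z)
⊕-assoc []      []      []      = refl
⊕-assoc (a ∷ x) (b ∷ y) (c ∷ z) = cong₂ _∷_ (Bool.xor-assoc a b c) (⊕-assoc x y z)

⊕-identityʳ : ∀ {r} (x : E2 r) → x ⊕ 𝟘 ≡ x
⊕-identityʳ []      = refl
⊕-identityʳ (a ∷ x) = cong₂ _∷_ (Bool.xor-identityʳ a) (⊕-identityʳ x)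

⊕-identityˡ : ∀ {r} (x : E2 r) → 𝟘 ⊕ x ≡ x
⊕-identityˡ x = trans (⊕-comm 𝟘 x) (⊕-identityʳ x)

⊕-self : ∀ {r} (x : E2 r) → x ⊕ x ≡ 𝟘
⊕-self []      = refl
⊕-self (a ∷ x) = cong₂ _∷_ (Bool.xor-same a) (⊕-self x)

⊕-cancelˡ : ∀ {r} (x y : E2 r) → x ⊕ (x ⊕ y) ≡ y
⊕-cancelˡ x y = begin
  x ⊕ (x ⊕ y) ≡⟨ ⊕-assoc x x y ⟨
  (x ⊕ x) ⊕ y ≡⟨ cong (_⊕ y) (⊕-self x) ⟩
  𝟘 ⊕ y       ≡⟨ ⊕-identityˡ y ⟩
  y           ∎
  where open ≡-Reasoning

⊕-injectiveʳ : ∀ {r} (t : E2 r) {x y : E2 r} → x ⊕ t ≡ y ⊕ t → x ≡ y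
⊕-injectiveʳ t {x} {y} e = begin
  x           ≡⟨ ⊕-cancelˡ t x ⟨
  t ⊕ (t ⊕ x) ≡⟨ cong (t ⊕_) (trans (⊕-comm t x) (trans e (⊕-comm y t))) ⟩
  t ⊕ (t ⊕ y) ≡⟨ ⊕-cancelˡ t y ⟩
  y           ∎
  where open ≡-Reasoning

⊕≡𝟘⇒≡ : ∀ {r} {x y : E2 r} → x ⊕ y ≡ 𝟘 → x ≡ y
⊕≡𝟘⇒≡ {y = y} e = ⊕-injectiveʳ y (trans e (sym (⊕-self y)))

_≟_ : ∀ {r} → DecidableEquality (E2 r)
_≟_ = ≡-dec Bool._≟_

module _ {a} {A : Set a} where

  Unique-resp-⊆ : {xs ys : List A} → xs ⊆ ys → Unique ys → Unique xs
  Unique-resp-⊆ []         []      = []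
  Unique-resp-⊆ (_ ∷ʳ τ)   (_ ∷ u) = Unique-resp-⊆ τ u
  Unique-resp-⊆ (refl ∷ τ) (p ∷ u) = All-resp-⊆ τ p ∷ Unique-resp-⊆ τ u

  Unique⇒length≤ : {xs ys : List A} → Unique xs → (∀ {x} → x ∈ₗ xs → x ∈ₗ ys) → length xs ≤ length ys
  Unique⇒length≤ []            _   = z≤n
  Unique⇒length≤ {x ∷ xs} (x∉xs ∷ u) sub with ∈-∃++ (sub (here refl))
  ... | us , vs , refl = ≤-trans (s≤s (Unique⇒length≤ u sub′))
                                 (≤-reflexive (sym length-middle))
    where
    sub′ : ∀ {z} → z ∈ₗ xs → z ∈ₗ us ++ vs
    sub′ z∈xs with ∈-++⁻ us (sub (there z∈xs))
    ... | inj₁ z∈us         = ∈-++⁺ˡ z∈us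
    ... | inj₂ (here refl)  = ⊥-elim (All.lookup x∉xs z∈xs refl)
    ... | inj₂ (there z∈vs) = ∈-++⁺ʳ us z∈vs
    length-middle : length (us ++ x ∷ vs) ≡ suc (length (us ++ vs))
    length-middle = begin
      length (us ++ x ∷ vs)            ≡⟨ length-++ us ⟩
      length us + suc (length vs)      ≡⟨ +-suc (length us) (length vs) ⟩
      suc (length us + length vs)      ≡⟨ cong suc (length-++ us) ⟨
      suc (length (us ++ vs))          ∎
      where open ≡-Reasoning

allVectors : ∀ r → List (E2 r)
allVectors zero    = [] ∷ []
allVectors (suc r) = map (true ∷_) (allVectors r) ++ map (false ∷_) (allVectors r)

length-allVectors : ∀ r → length (allVectors r) ≡ 2 ^ r
length-allVectors zero    = refl
length-allVectors (suc r) = begin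
  length (map (true ∷_) V ++ map (false ∷_) V)      ≡⟨ length-++ (map (true ∷_) V) ⟩
  length (map (true ∷_) V) + length (map (false ∷_) V)
    ≡⟨ cong₂ _+_ (length-map (true ∷_) V) (length-map (false ∷_) V) ⟩
  length V + length V                               ≡⟨ cong₂ _+_ (length-allVectors r) (length-allVectors r) ⟩
  2 ^ r + 2 ^ r                                     ≡⟨ cong (2 ^ r +_) (+-identityʳ (2 ^ r)) ⟨
  2 ^ suc r                                         ∎
  where
  V = allVectors r
  open ≡-Reasoning

∈-allVectors : ∀ {r} (v : E2 r) → v ∈ₗ allVectors r
∈-allVectors []          = here refl
∈-allVectors (true ∷ v)  = ∈-++⁺ˡ (∈-map⁺ _ (∈-allVectors v))
∈-allVectors (false ∷ v) = ∈-++⁺ʳ (map (true ∷_) (allVectors _)) (∈-map⁺ _ (∈-allVectors v))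

allVectors-unique : ∀ r → Unique (allVectors r)
allVectors-unique zero    = [] ∷ []
allVectors-unique (suc r) =
  Unique.++⁺ (Unique.map⁺ ∷-injectiveʳ (allVectors-unique r))
             (Unique.map⁺ ∷-injectiveʳ (allVectors-unique r))
             disjoint
  where
  disjoint : ∀ {v} → ¬ (v ∈ₗ map (true ∷_) (allVectors r) × v ∈ₗ map (false ∷_) (allVectors r))
  disjoint (v∈T , v∈F) with ∈-map⁻ (true ∷_) v∈T | ∈-map⁻ (false ∷_) v∈F
  ... | _ , _ , refl | _ , _ , ()

length≤2^ : ∀ {r} {L : List (E2 r)} → Unique L → length L ≤ 2 ^ r
length≤2^ {r} u = ≤-trans (Unique⇒length≤ u (λ {v} _ → ∈-allVectors v))
                          (≤-reflexive (length-allVectors r))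

translate-disjoint⇒length≤ : ∀ {r} (t : E2 (suc r)) {L : List (E2 (suc r))} →
                             Unique L → (∀ {b} → b ∈ₗ L → b ⊕ t ∉ₗ L) → length L ≤ 2 ^ r
translate-disjoint⇒length≤ {r} t {L} u disjoint = *-cancelˡ-≤ 2 (subst (_≤ 2 ^ suc r) doubled
  (length≤2^ (Unique.++⁺ u (Unique.map⁺ (⊕-injectiveʳ t) u) disjoint′)))
  where
  disjoint′ : ∀ {v} → ¬ (v ∈ₗ L × v ∈ₗ map (_⊕ t) L)
  disjoint′ (v∈L , v∈L+t) with ∈-map⁻ (_⊕ t) v∈L+t
  ... | b , b∈L , refl = disjoint b∈L v∈L
  doubled : length (L ++ map (_⊕ t) L) ≡ 2 * length L
  doubled = trans (length-++ L) (cong (length L +_)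
                  (trans (length-map (_⊕ t) L) (sym (+-identityʳ (length L)))))

∈1^ : ∀ {r} {x : E2 r} {L} → x ∈ₗ L → x ∈ 1 ^ L
∈1^ {x = x} x∈L = x ∷ [] , from∈ x∈L , refl , ⊕-identityʳ x

∈^-∷ʳ : ∀ {r h} {g : E2 r} y {L} → g ∈ h ^ L → g ∈ h ^ (y ∷ L)
∈^-∷ʳ y (B , τ , |B| , ΣB) = B , y ∷ʳ τ , |B| , ΣB

∈^-∷ : ∀ {r h} {g : E2 r} x {L} → g ∈ h ^ L → (x ⊕ g) ∈ suc h ^ (x ∷ L)
∈^-∷ x (B , τ , |B| , ΣB) = x ∷ B , refl ∷ τ , cong suc |B| , cong (x ⊕_) ΣB

x⊕yz≡y⊕xz : ∀ {r} (x y z : E2 r) → x ⊕ (y ⊕ z) ≡ y ⊕ (x ⊕ z)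
x⊕yz≡y⊕xz x y z = begin
  x ⊕ (y ⊕ z) ≡⟨ ⊕-assoc x y z ⟨
  (x ⊕ y) ⊕ z ≡⟨ cong (_⊕ z) (⊕-comm x y) ⟩
  (y ⊕ x) ⊕ z ≡⟨ ⊕-assoc y x z ⟩
  y ⊕ (x ⊕ z) ∎
  where open ≡-Reasoning

∈^-swap : ∀ {r h} {g x y : E2 r} {L} → g ∈ h ^ (x ∷ y ∷ L) → g ∈ h ^ (y ∷ x ∷ L)
∈^-swap (B , x ∷ʳ y ∷ʳ τ   , |B| , ΣB) = B , y ∷ʳ x ∷ʳ τ   , |B| , ΣB
∈^-swap (B , x ∷ʳ refl ∷ τ , |B| , ΣB) = B , refl ∷ x ∷ʳ τ , |B| , ΣB
∈^-swap (B , refl ∷ y ∷ʳ τ , |B| , ΣB) = B , y ∷ʳ refl ∷ τ , |B| , ΣB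
∈^-swap (x ∷ y ∷ B , refl ∷ refl ∷ τ , |B| , ΣB) =
  y ∷ x ∷ B , refl ∷ refl ∷ τ , |B| , trans (x⊕yz≡y⊕xz y x (Σ⊕ B)) ΣB

⊕-∈2^ : ∀ {r} {x y : E2 r} {L} → x ∈ₗ L → y ∈ₗ L → x ≢ y → (x ⊕ y) ∈ 2 ^ L
⊕-∈2^ (here refl)  (here refl)  x≢y = ⊥-elim (x≢y refl)
⊕-∈2^ (here refl)  (there y∈L) _   = ∈^-∷ _ (∈1^ y∈L)
⊕-∈2^ (there x∈L) (here refl)  _   = subst (_∈ 2 ^ _) (⊕-comm _ _) (∈^-∷ _ (∈1^ x∈L))
⊕-∈2^ (there x∈L) (there y∈L) x≢y = ∈^-∷ʳ _ (⊕-∈2^ x∈L y∈L x≢y)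

-- By counting, L meets its translate L ⊕ t, which yields b ≠ b ⊕ t in L.
∈2^-of-large : ∀ {r} {t : E2 (suc r)} {L} → t ≢ 𝟘 → Unique L → 2 ^ r < length L → t ∈ 2 ^ L
∈2^-of-large {t = t} {L} t≢𝟘 u large with any? (λ b → any? ((b ⊕ t) ≟_) L) L
... | no disjoint = ⊥-elim (<⇒≱ large (translate-disjoint⇒length≤ t u (λ b∈L → disjoint ∘ lose b∈L)))
... | yes meets with b , b∈L , b⊕t∈L ← find meets =
  subst (_∈ 2 ^ L) (⊕-cancelˡ b t) (⊕-∈2^ b∈L b⊕t∈L b≢b⊕t)
  where
  b≢b⊕t : b ≢ b ⊕ t
  b≢b⊕t e = t≢𝟘 (trans (sym (⊕-cancelˡ b t)) (trans (cong (b ⊕_) (sym e)) (⊕-self b)))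

∈3^-∷ : ∀ {r} {x g : E2 (suc r)} {L} → x ≢ g → Unique L → 2 ^ r < length L → g ∈ 3 ^ (x ∷ L)
∈3^-∷ {x = x} {g} x≢g u large =
  subst (_∈ 3 ^ _) (⊕-cancelˡ x g) (∈^-∷ x (∈2^-of-large (x≢g ∘ ⊕≡𝟘⇒≡) u large))

∈3^-of-large : ∀ {r} {A : List (E2 (suc r))} → Unique A → suc (2 ^ r) < length A → ∀ g → g ∈ 3 ^ A
∈3^-of-large {A = a ∷ a′ ∷ L} ((a≢a′ ∷ a∉L) ∷ a′∉L ∷ u) (s≤s (s≤s large)) g with a ≟ g
... | no a≢g   = ∈3^-∷ a≢g (a′∉L ∷ u) (s≤s large)
... | yes refl = ∈^-swap (∈3^-∷ (a≢a′ ∘ sym) (a∉L ∷ u) (s≤s large))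

InCoset : ∀ {r} → E2 (suc r) → Set
InCoset x = ∃ λ u → x ≡ true ∷ u

coset : ∀ r → List (E2 (suc r))
coset r = map (true ∷_) (allVectors r)

coset-InCoset : ∀ r → All InCoset (coset r)
coset-InCoset r = All.map⁺ (All.universal (λ u → u , refl) (allVectors r))

length-coset : ∀ r → length (coset r) ≡ 2 ^ r
length-coset r = trans (length-map (true ∷_) (allVectors r)) (length-allVectors r)

coset-unique : ∀ r → Unique (coset r)
coset-unique r = Unique.map⁺ ∷-injectiveʳ (allVectors-unique r)

Σ⊕-InCoset₃≢𝟘 : ∀ {r} {x y z : E2 (suc r)} → All InCoset (x ∷ y ∷ z ∷ []) → Σ⊕ (x ∷ y ∷ z ∷ []) ≢ 𝟘
Σ⊕-InCoset₃≢𝟘 ((_ , refl) ∷ (_ , refl) ∷ (_ , refl) ∷ []) ()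

𝟘∉3^ : ∀ r → ¬ (𝟘 ∈ 3 ^ (𝟘 ∷ coset r))
𝟘∉3^ r (x ∷ y ∷ z ∷ [] , _ ∷ʳ τ , refl , ΣB≡𝟘) = Σ⊕-InCoset₃≢𝟘 (All-resp-⊆ τ (coset-InCoset r)) ΣB≡𝟘
𝟘∉3^ r (_ ∷ x ∷ y ∷ [] , refl ∷ τ , refl , ΣB≡𝟘) with Unique-resp-⊆ τ (coset-unique r)
... | (x≢y ∷ []) ∷ _ = x≢y (⊕≡𝟘⇒≡ (begin
  x ⊕ y             ≡⟨ cong (x ⊕_) (⊕-identityʳ y) ⟨
  x ⊕ (y ⊕ 𝟘)       ≡⟨ ⊕-identityˡ _ ⟨
  𝟘 ⊕ (x ⊕ (y ⊕ 𝟘)) ≡⟨ ΣB≡𝟘 ⟩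
  𝟘                 ∎))
  where open ≡-Reasoning

theorem2p5 : ∀ (r : ℕ) → IsC 3 (suc r) (2 ^ r + 1)
theorem2p5 r = (𝟘 ∷ coset r , unique , size , λ all → 𝟘∉3^ r (all 𝟘)) , upper
  where
  unique : Unique (𝟘 ∷ coset r)
  unique = All.map (λ { (_ , refl) () }) (coset-InCoset r) ∷ coset-unique r
  size : length (𝟘 ∷ coset r) ≡ 2 ^ r + 1
  size = trans (cong suc (length-coset r)) (+-comm 1 (2 ^ r))
  upper : ∀ A → Unique A → RestrictedSumsetProper 3 A → length A ≤ 2 ^ r + 1
  upper A u proper = subst (length A ≤_) (+-comm 1 (2 ^ r))
                           (≮⇒≥ (λ large → proper (∈3^-of-large u large)))
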